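{- Let $d\ge 1$ be an integer and let $n_1,\dots,n_d$ be positive integers. (i) Let $M\subset\mathcal{P}([d])$ be non-empty and let $B\subset[d]$. Then the $M$-covering number of any $B$-subspace is equal to $\min_{B'\in M}\prod_{j\in B\setminus B'} n_j$. In particular, if $n_1=\dots=n_d=n$, this quantity equals $n^{\min_{B'\in M}|B\setminus B'|}$, which is equal to $1$ if $B$ is contained in some $B'\in M$ and is at least $n$ otherwise. (ii) Let $M_1,M_2\subset\mathcal{P}([d])$ be non-empty and let $k_1,k_2$ be nonnegative integers. If $A\subset[n_1]\times\dots\times[n_d]$ satisfies $\mathrm{c}_{M_1}(A)\le k_1$ and $\mathrm{c}_{M_2}(A)\le k_2$, then $\mathrm{c}_{M_1\wedge M_2}(A)\le k_1k_2$, where $M_1\wedge M_2=\{B_1\cap B_2 : B_1\in M_1, B_2\in M_2\}$.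
   Context: $[k]=\{1,\dots,k\}$. For $B \subset [d]$, a $B$-subspace is a maximal subset $S$ of $[n_1]\times\dots\times[n_d]$ such that $x_i = y_i$ whenever $x,y\in S$ and $i \notin B$ (equivalently, a set of the form $\{x : x_i = a_i \text{ for all } i\notin B\}$). For non-empty $M\subset\mathcal{P}([d])$, an $M$-subspace is a $B$-subspace for some $B\in M$. The $M$-covering number $\mathrm{c}_M(A)$ of $A\subset[n_1]\times\dots\times[n_d]$ is the smallest nonnegative integer $k$ such that $A$ is contained in a union of $k$ $M$-subspaces. -}

module Defs where

open import Data.Nat using (ℕ; zero; suc; _*_; _≤_)
open import Data.Fin using (Fin) renaming (zero to fzero; suc to fsuc)
open import Data.Fin.Subset using (Subset; _∈_; _∉_; _∩_; _─_; inside; outside)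
open import Data.Vec using (_∷_; [])
open import Data.Product using (Σ; ∃; ∃-syntax; _×_; _,_; proj₁; proj₂)
open import Relation.Binary.PropositionalEquality using (_≡_)

-- Points of [n_1] × … × [n_d]  (coordinate i ranges over Fin (n i), i.e. n i values)
Point : {d : ℕ} → (Fin d → ℕ) → Set
Point {d} n = (i : Fin d) → Fin (n i)

Region : {d : ℕ} → (Fin d → ℕ) → Set₁
Region n = Point n → Set

Family : ℕ → Set₁
Family d = Subset d → Set

NonEmptyFamily : {d : ℕ} → Family d → Set
NonEmptyFamily M = ∃[ B ] M B

subspace : {d : ℕ} {n : Fin d → ℕ} → Subset d → Point n → Region n
subspace B a x = ∀ i → i ∉ B → x i ≡ a i

_⊆R_ : {d : ℕ} {n : Fin d → ℕ} → Region n → Region n → Set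
A ⊆R A' = ∀ x → A x → A' x

-- A is contained in a union of k M-subspaces
-- (a family of k pairs (B_j, a_j) with B_j ∈ M; the j-th subspace is subspace B_j a_j)
CoveredBy : {d : ℕ} {n : Fin d → ℕ} → Family d → Region n → ℕ → Set
CoveredBy {d} {n} M A k =
  Σ (Fin k → Subset d × Point n) λ S →
    (∀ j → M (proj₁ (S j))) ×
    (∀ x → A x → ∃[ j ] subspace (proj₁ (S j)) (proj₂ (S j)) x)

IsCoveringNumber : {d : ℕ} {n : Fin d → ℕ} → Family d → Region n → ℕ → Set
IsCoveringNumber M A c = CoveredBy M A c × (∀ k → CoveredBy M A k → c ≤ k)

prodOver : {d : ℕ} → Subset d → (Fin d → ℕ) → ℕ
prodOver [] n = 1
prodOver (inside ∷ S) n = n fzero * prodOver S (λ i → n (fsuc i))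
prodOver (outside ∷ S) n = prodOver S (λ i → n (fsuc i))

IsMinOver : {d : ℕ} → Family d → (Subset d → ℕ) → ℕ → Set
IsMinOver M f m = (∃[ B' ] (M B' × f B' ≡ m)) × (∀ B' → M B' → m ≤ f B')

_∧F_ : {d : ℕ} → Family d → Family d → Family d
(M₁ ∧F M₂) B = ∃[ B₁ ] ∃[ B₂ ] (M₁ B₁ × M₂ B₂ × B ≡ B₁ ∩ B₂)

{-# OPTIONS --safe #-}
module Submission where

-- The B-subspace has ∏_{B} n points, and a B'-subspace meets it in at most
-- ∏_{B ∩ B'} n of them.  Hence if k M-subspaces cover it, then
-- ∏_{B} n ≤ ∑_j ∏_{B ∩ Bⱼ} n = ∑_j ∏_{B} n / ∏_{B ─ Bⱼ} n, which forces
-- ∏_{B ─ Bⱼ} n ≤ k for some j.  Conversely, the B'-subspaces through the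
-- ∏_{B ─ B'} n points obtained by varying a on B ─ B' cover the B-subspace.
-- For (ii), a point lying in an M₁-subspace S₁ and an M₂-subspace S₂ lies in
-- S₁ ∩ S₂, which is an (M₁ ∧ M₂)-subspace; there are k₁ k₂ such pairs.

open import Defs
open import Data.Bool using (Bool; true; false; _∧_; _∨_; if_then_else_)
open import Data.Fin using (Fin; combine; remQuot) renaming (zero to fzero; suc to fsuc)
open import Data.Fin.Properties using (_≟_; any?; remQuot-combine)
open import Data.Fin.Subset using (Subset; _⊆_; _─_; ∣_∣; _∈_; _∉_; _∩_; inside; outside)
open import Data.Fin.Subset.Properties
  using (_∈?_; x∈p∩q⁺; x∈p∧x∉q⇒x∈p─q; p─q⊆p; drop-∷-⊆; x∈p⇒∣p-x∣<∣p∣)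
open import Data.Nat using (ℕ; zero; suc; _+_; _*_; _^_; _≤_; z≤n; _≤?_; NonZero; >-nonZero)
open import Data.Nat.Properties
  using ( ≤-refl; ≤-reflexive; ≤-trans; <-≤-trans; <-irrefl; n≮0; ≰⇒>; n≤0⇒n≡0; n≢0⇒n>0
        ; m≤m+n; m<n+m; +-mono-≤; +-identityʳ; *-comm; *-assoc; *-mono-≤; *-monoʳ-≤
        ; ^-identityʳ; ^-monoʳ-≤; module ≤-Reasoning; *-commutativeSemigroup; +-*-semiring )
open import Algebra.Properties.CommutativeSemigroup *-commutativeSemigroup
  using (x∙yz≈y∙xz)
open import Algebra.Properties.Semiring.Sum +-*-semiring
  using (sum-syntax; ∑-comm; *-distribˡ-sum; sum-cong-≗; sum-replicate-zero; sum-remove)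
open import Data.Product using (∃-syntax; _×_; _,_; proj₁; proj₂; uncurry)
open import Data.Vec using (_∷_; []; here; there; head; tail)
open import Function using (_∘_)
open import Relation.Binary.PropositionalEquality
  using (_≡_; refl; sym; trans; cong; cong₂; cong-app; subst)
open import Relation.Nullary using (¬_; yes; no; does; contradiction)
open import Relation.Nullary.Decidable using (dec-true)

∑-mono-≤ : ∀ {k} {f g : Fin k → ℕ} → (∀ j → f j ≤ g j) → ∑[ j < k ] f j ≤ ∑[ j < k ] g j
∑-mono-≤ {zero}  _   = z≤n
∑-mono-≤ {suc k} f≤g = +-mono-≤ (f≤g fzero) (∑-mono-≤ (f≤g ∘ fsuc))

∑-const : ∀ k c → ∑[ _ < k ] c ≡ k * c
∑-const zero    c = refl
∑-const (suc k) c = cong (c +_) (∑-const k c)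

f≤∑f : ∀ {k} (f : Fin k → ℕ) j → f j ≤ ∑[ i < k ] f i
f≤∑f {suc k} f j = ≤-trans (m≤m+n (f j) _) (≤-reflexive (sym (sum-remove {i = j} f)))

∑-indicator : ∀ {m} (u : Fin m) c → ∑[ v < m ] (if does (u ≟ v) then c else 0) ≡ c
∑-indicator {suc m} fzero    c = trans (cong (c +_) (sum-replicate-zero m)) (+-identityʳ c)
∑-indicator {suc m} (fsuc u) c = ∑-indicator u c

prodOver-∩-─ : ∀ {d} (n : Fin d → ℕ) (B C : Subset d) →
  prodOver B n ≡ prodOver (B ∩ C) n * prodOver (B ─ C) n
prodOver-∩-─ n []            []            = refl
prodOver-∩-─ n (inside ∷ B)  (inside ∷ C)  =
  trans (cong (n fzero *_) (prodOver-∩-─ (n ∘ fsuc) B C)) (sym (*-assoc (n fzero) _ _))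
prodOver-∩-─ n (inside ∷ B)  (outside ∷ C) =
  trans (cong (n fzero *_) (prodOver-∩-─ (n ∘ fsuc) B C))
        (x∙yz≈y∙xz (n fzero) (prodOver (B ∩ C) (n ∘ fsuc)) _)
prodOver-∩-─ n (outside ∷ B) (inside ∷ C)  = prodOver-∩-─ (n ∘ fsuc) B C
prodOver-∩-─ n (outside ∷ B) (outside ∷ C) = prodOver-∩-─ (n ∘ fsuc) B C

1≤prodOver : ∀ {d} {n : Fin d → ℕ} → (∀ i → 1 ≤ n i) → (C : Subset d) → 1 ≤ prodOver C n
1≤prodOver n≥1 []            = ≤-refl
1≤prodOver n≥1 (inside ∷ C)  = *-mono-≤ (n≥1 fzero) (1≤prodOver (n≥1 ∘ fsuc) C)
1≤prodOver n≥1 (outside ∷ C) = 1≤prodOver (n≥1 ∘ fsuc) C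

prodOver-const : ∀ {d} {n : Fin d → ℕ} {N} → (∀ i → n i ≡ N) → (C : Subset d) →
  prodOver C n ≡ N ^ ∣ C ∣
prodOver-const n≡N []            = refl
prodOver-const n≡N (inside ∷ C)  = cong₂ _*_ (n≡N fzero) (prodOver-const (n≡N ∘ fsuc) C)
prodOver-const n≡N (outside ∷ C) = prodOver-const (n≡N ∘ fsuc) C

p⊆q⇒∣p─q∣≡0 : ∀ {d} {p q : Subset d} → p ⊆ q → ∣ p ─ q ∣ ≡ 0
p⊆q⇒∣p─q∣≡0 {p = []}          {[]}          _   = refl
p⊆q⇒∣p─q∣≡0 {p = _ ∷ p}       {inside ∷ q}  p⊆q = p⊆q⇒∣p─q∣≡0 (drop-∷-⊆ p⊆q)
p⊆q⇒∣p─q∣≡0 {p = outside ∷ p} {outside ∷ q} p⊆q = p⊆q⇒∣p─q∣≡0 (drop-∷-⊆ p⊆q)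
p⊆q⇒∣p─q∣≡0 {p = inside ∷ p}  {outside ∷ q} p⊆q = contradiction (p⊆q here) λ ()

∣p─q∣≡0⇒p⊆q : ∀ {d} {p q : Subset d} → ∣ p ─ q ∣ ≡ 0 → p ⊆ q
∣p─q∣≡0⇒p⊆q {q = q} ∣p─q∣≡0 {x} x∈p with x ∈? q
... | yes x∈q = x∈q
... | no  x∉q =
  contradiction (<-≤-trans (x∈p⇒∣p-x∣<∣p∣ (x∈p∧x∉q⇒x∈p─q x∈p x∉q)) (≤-reflexive ∣p─q∣≡0)) n≮0

module _ {d : ℕ} {n : Fin (suc d) → ℕ} where

  infixr 5 _∷ᴾ_
  _∷ᴾ_ : Fin (n fzero) → Point (n ∘ fsuc) → Point n
  (v ∷ᴾ y) fzero    = v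
  (v ∷ᴾ y) (fsuc i) = y i

  subspace-tail : ∀ {C : Subset (suc d)} {a x : Point n} →
    subspace C a x → subspace (tail C) (a ∘ fsuc) (x ∘ fsuc)
  subspace-tail {_ ∷ C} x∈S i i∉C = x∈S (fsuc i) λ { (there i∈C) → i∉C i∈C }

  subspace-∷ : ∀ {c B} {a : Point n} {v y} → (fzero ∉ c ∷ B → v ≡ a fzero) →
    subspace B (a ∘ fsuc) y → subspace (c ∷ B) a (v ∷ᴾ y)
  subspace-∷ v≡a₀ y∈S fzero    0∉B = v≡a₀ 0∉B
  subspace-∷ v≡a₀ y∈S (fsuc i) i∉B = y∈S i (i∉B ∘ there)

  tailᴿ : Subset (suc d) × Point n → Subset d × Point (n ∘ fsuc)
  tailᴿ (C , c) = tail C , c ∘ fsuc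

  meetsSlice : Subset (suc d) × Point n → Fin (n fzero) → Bool
  meetsSlice (C , c) v = head C ∨ does (c fzero ≟ v)

  meetsSlice-∋ : ∀ {S x} → uncurry subspace S x → meetsSlice S (x fzero) ≡ true
  meetsSlice-∋ {inside ∷ C , c}  x∈S = refl
  meetsSlice-∋ {outside ∷ C , c} x∈S = dec-true (c fzero ≟ _) (sym (x∈S fzero λ ()))

enumerate : ∀ {d} {n : Fin d → ℕ} (C : Subset d) → Point n → Fin (prodOver C n) → Point n
enumerate []            a _ = a
enumerate (outside ∷ C) a j = a fzero ∷ᴾ enumerate C (a ∘ fsuc) j
enumerate {n = n} (inside ∷ C) a j =
  let v , j′ = remQuot {n fzero} (prodOver C (n ∘ fsuc)) j in v ∷ᴾ enumerate C (a ∘ fsuc) j′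

enumerate-∉ : ∀ {d} {n : Fin d → ℕ} (C : Subset d) (a : Point n) j {i} → i ∉ C →
  enumerate C a j i ≡ a i
enumerate-∉ (outside ∷ C) a j {fzero}  _   = refl
enumerate-∉ (outside ∷ C) a j {fsuc i} i∉C = enumerate-∉ C (a ∘ fsuc) j (i∉C ∘ there)
enumerate-∉ (inside ∷ C)  a j {fzero}  i∉C = contradiction here i∉C
enumerate-∉ (inside ∷ C)  a j {fsuc i} i∉C = enumerate-∉ C (a ∘ fsuc) _ (i∉C ∘ there)

enumerate-onto : ∀ {d} {n : Fin d → ℕ} (C : Subset d) (a x : Point n) →
  ∃[ j ] (∀ {i} → i ∈ C → enumerate C a j i ≡ x i)
enumerate-onto []            a x = fzero , λ ()
enumerate-onto (outside ∷ C) a x with enumerate-onto C (a ∘ fsuc) (x ∘ fsuc)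
... | j , agree = j , λ { (there i∈C) → agree i∈C }
enumerate-onto {n = n} (inside ∷ C) a x with enumerate-onto C (a ∘ fsuc) (x ∘ fsuc)
... | j , agree = combine (x fzero) j , λ i∈C → trans (cong-app enumerate-combine _) (agree′ i∈C)
  where
  extend : Fin (n fzero) × Fin (prodOver C (n ∘ fsuc)) → Point n
  extend (v , j′) = v ∷ᴾ enumerate C (a ∘ fsuc) j′
  enumerate-combine : enumerate (inside ∷ C) a (combine (x fzero) j) ≡ extend (x fzero , j)
  enumerate-combine = cong extend (remQuot-combine (x fzero) j)
  agree′ : ∀ {i} → i ∈ inside ∷ C → extend (x fzero , j) i ≡ x i
  agree′ here        = refl
  agree′ (there i∈C) = agree i∈C

subspace-coveredBy : ∀ {d} {n : Fin d → ℕ} {M : Family d} {B′} → M B′ →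
  (B : Subset d) (a : Point n) → CoveredBy M (subspace B a) (prodOver (B ─ B′) n)
subspace-coveredBy {B′ = B′} B′∈M B a =
  (λ j → B′ , enumerate (B ─ B′) a j) , (λ _ → B′∈M) , cover
  where
  cover : ∀ x → subspace B a x → ∃[ j ] subspace B′ (enumerate (B ─ B′) a j) x
  cover x x∈S with j , agree ← enumerate-onto (B ─ B′) a x = j , agree-off-B′
    where
    agree-off-B′ : ∀ i → i ∉ B′ → x i ≡ enumerate (B ─ B′) a j i
    agree-off-B′ i i∉B′ with i ∈? B
    ... | yes i∈B = sym (agree (x∈p∧x∉q⇒x∈p─q i∈B i∉B′))
    ... | no  i∉B = trans (x∈S i i∉B) (sym (enumerate-∉ (B ─ B′) a j (i∉B ∘ p─q⊆p B B′)))

Covers : ∀ {d k} {n : Fin d → ℕ} → (Fin k → Subset d × Point n) → (Fin k → Bool) →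
  Region n → Set
Covers S selected A = ∀ x → A x → ∃[ j ] (selected j ≡ true × uncurry subspace (S j) x)

∑-over-slices : ∀ {d} {n : Fin (suc d) → ℕ} (B : Subset d) (s : Bool)
  (S : Subset (suc d) × Point n) →
  ∑[ v < n fzero ] (if s ∧ meetsSlice S v then prodOver (B ∩ tail (proj₁ S)) (n ∘ fsuc) else 0)
    ≡ (if s then prodOver ((inside ∷ B) ∩ proj₁ S) n else 0)
∑-over-slices {n = n} B false S                = sum-replicate-zero (n fzero)
∑-over-slices {n = n} B true  (inside ∷ C , c)  = ∑-const (n fzero) _
∑-over-slices         B true  (outside ∷ C , c) = ∑-indicator (c fzero) _

prodOver-outside∷-∩ : ∀ {d} {n : Fin (suc d) → ℕ} (B : Subset d) (C : Subset (suc d)) →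
  prodOver ((outside ∷ B) ∩ C) n ≡ prodOver (B ∩ tail C) (n ∘ fsuc)
prodOver-outside∷-∩ B (_ ∷ C) = refl

-- Selecting a subfamily lets the induction on d restrict a cover to the members
-- meeting a given slice x fzero ≡ v.
prodOver≤∑prodOver-∩ : ∀ {d k} {n : Fin d → ℕ} (B : Subset d) (a : Point n)
  (S : Fin k → Subset d × Point n) (selected : Fin k → Bool) →
  Covers S selected (subspace B a) →
  prodOver B n ≤ ∑[ j < k ] (if selected j then prodOver (B ∩ proj₁ (S j)) n else 0)
prodOver≤∑prodOver-∩ {zero} {n = n} [] a S selected cover with cover a (λ ())
... | j , selected-j , _ = ≤-trans (1≤term (proj₁ (S j)) selected-j) (f≤∑f _ j)
  where
  1≤term : (C : Subset 0) → selected j ≡ true →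
    1 ≤ (if selected j then prodOver ([] ∩ C) n else 0)
  1≤term [] eq rewrite eq = ≤-refl
prodOver≤∑prodOver-∩ {suc d} {k} {n} (outside ∷ B) a S selected cover = begin
  prodOver B (n ∘ fsuc)
    ≤⟨ prodOver≤∑prodOver-∩ B (a ∘ fsuc) (tailᴿ ∘ S) selected cover-tail ⟩
  ∑[ j < k ] (if selected j then prodOver (B ∩ tail (proj₁ (S j))) (n ∘ fsuc) else 0)
    ≡⟨ sum-cong-≗ (λ j → cong (λ p → if selected j then p else 0)
                               (sym (prodOver-outside∷-∩ B (proj₁ (S j))))) ⟩
  ∑[ j < k ] (if selected j then prodOver ((outside ∷ B) ∩ proj₁ (S j)) n else 0) ∎
  where
  open ≤-Reasoning
  cover-tail : Covers (tailᴿ ∘ S) selected (subspace B (a ∘ fsuc))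
  cover-tail y y∈S
    with j , selected-j , x∈Sⱼ ← cover (a fzero ∷ᴾ y) (subspace-∷ (λ _ → refl) y∈S)
    = j , selected-j , subspace-tail x∈Sⱼ
prodOver≤∑prodOver-∩ {suc d} {k} {n} (inside ∷ B) a S selected cover = begin
  n fzero * prodOver B (n ∘ fsuc)
    ≡⟨ ∑-const (n fzero) _ ⟨
  ∑[ v < n fzero ] prodOver B (n ∘ fsuc)
    ≤⟨ ∑-mono-≤ (λ v → prodOver≤∑prodOver-∩ B (a ∘ fsuc) (tailᴿ ∘ S)
                                            (selected-meeting v) (cover-slice v)) ⟩
  ∑[ v < n fzero ] ∑[ j < k ] term v j
    ≡⟨ ∑-comm term ⟩
  ∑[ j < k ] ∑[ v < n fzero ] term v j
    ≡⟨ sum-cong-≗ (λ j → ∑-over-slices B (selected j) (S j)) ⟩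
  ∑[ j < k ] (if selected j then prodOver ((inside ∷ B) ∩ proj₁ (S j)) n else 0) ∎
  where
  open ≤-Reasoning
  selected-meeting : Fin (n fzero) → Fin k → Bool
  selected-meeting v j = selected j ∧ meetsSlice (S j) v
  term : Fin (n fzero) → Fin k → ℕ
  term v j = if selected-meeting v j then prodOver (B ∩ tail (proj₁ (S j))) (n ∘ fsuc) else 0
  cover-slice : ∀ v → Covers (tailᴿ ∘ S) (selected-meeting v) (subspace B (a ∘ fsuc))
  cover-slice v y y∈S
    with j , selected-j , x∈Sⱼ ← cover (v ∷ᴾ y) (subspace-∷ (λ 0∉B → contradiction here 0∉B) y∈S)
    = j , cong₂ _∧_ selected-j (meetsSlice-∋ x∈Sⱼ) , subspace-tail x∈Sⱼ

some-cofactor≤count : ∀ {k} p (f g : Fin k → ℕ) → 1 ≤ p → (∀ j → p ≡ f j * g j) →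
  p ≤ ∑[ j < k ] f j → ∃[ j ] g j ≤ k
some-cofactor≤count {k} p f g p≥1 p≡fg p≤∑f with any? (λ j → g j ≤? k)
... | yes small = small
... | no  none  = contradiction (begin-strict
  k * p                      <⟨ m<n+m (k * p) p≥1 ⟩
  suc k * p                  ≤⟨ *-monoʳ-≤ (suc k) p≤∑f ⟩
  suc k * (∑[ j < k ] f j)   ≡⟨ *-distribˡ-sum (suc k) f ⟩
  ∑[ j < k ] (suc k * f j)   ≤⟨ ∑-mono-≤ (λ j → subst (_ ≤_) (sym (p≡fg j)) ([1+k]f≤fg j)) ⟩
  ∑[ j < k ] p               ≡⟨ ∑-const k p ⟩
  k * p                      ∎) (<-irrefl refl)
  where
  open ≤-Reasoning
  [1+k]f≤fg : ∀ j → suc k * f j ≤ f j * g j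
  [1+k]f≤fg j = subst (_≤ f j * g j) (*-comm (f j) (suc k)) (*-monoʳ-≤ (f j) (≰⇒> (none ∘ (j ,_))))

subspace-cover⇒prodOver─≤ : ∀ {d k} {n : Fin d → ℕ} → (∀ i → 1 ≤ n i) →
  (B : Subset d) (a : Point n) (S : Fin k → Subset d × Point n) →
  (∀ x → subspace B a x → ∃[ j ] uncurry subspace (S j) x) →
  ∃[ j ] prodOver (B ─ proj₁ (S j)) n ≤ k
subspace-cover⇒prodOver─≤ {n = n} n≥1 B a S cover =
  some-cofactor≤count (prodOver B n)
    (λ j → prodOver (B ∩ proj₁ (S j)) n) (λ j → prodOver (B ─ proj₁ (S j)) n)
    (1≤prodOver n≥1 B) (λ j → prodOver-∩-─ n B (proj₁ (S j)))
    (prodOver≤∑prodOver-∩ B a S (λ _ → true)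
      λ x x∈S → let j , x∈Sⱼ = cover x x∈S in j , refl , x∈Sⱼ)

subspace-coveringNumber : ∀ {d} {n : Fin d → ℕ} → (∀ i → 1 ≤ n i) →
  (M : Family d) (B : Subset d) (a : Point n) {m : ℕ} →
  IsMinOver M (λ B′ → prodOver (B ─ B′) n) m → IsCoveringNumber M (subspace B a) m
subspace-coveringNumber n≥1 M B a ((B′ , B′∈M , refl) , m-min) =
  subspace-coveredBy B′∈M B a , λ k (S , S∈M , cover) →
    let j , bound = subspace-cover⇒prodOver─≤ n≥1 B a S cover
    in ≤-trans (m-min (proj₁ (S j)) (S∈M j)) bound

IsMinOver-∘ : ∀ {d} {M : Family d} {f h : Subset d → ℕ} {g : ℕ → ℕ} {m} →
  (∀ {x y} → x ≤ y → g x ≤ g y) → (∀ B → h B ≡ g (f B)) →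
  IsMinOver M f m → IsMinOver M h (g m)
IsMinOver-∘ g-mono h≡g∘f ((B , B∈M , refl) , m≤f) =
  (B , B∈M , h≡g∘f B) ,
  λ B′ B′∈M → subst (_ ≤_) (sym (h≡g∘f B′)) (g-mono (m≤f B′ B′∈M))

module _ {d} {M : Family d} {B : Subset d} {e} (e-min : IsMinOver M (λ B′ → ∣ B ─ B′ ∣) e) where

  minCodim≡0 : ∃[ B′ ] (M B′ × B ⊆ B′) → e ≡ 0
  minCodim≡0 (B′ , B′∈M , B⊆B′) =
    n≤0⇒n≡0 (subst (e ≤_) (p⊆q⇒∣p─q∣≡0 B⊆B′) (proj₂ e-min B′ B′∈M))

  minCodim≥1 : ¬ (∃[ B′ ] (M B′ × B ⊆ B′)) → 1 ≤ e
  minCodim≥1 no-superset with B₀ , B₀∈M , ∣B─B₀∣≡e ← proj₁ e-min =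
    n≢0⇒n>0 λ e≡0 → no-superset (B₀ , B₀∈M , ∣p─q∣≡0⇒p⊆q (trans ∣B─B₀∣≡e e≡0))

subspace-coveringNumber-uniform : ∀ {d} {n : Fin d → ℕ} {N} → 1 ≤ N → (∀ i → n i ≡ N) →
  (M : Family d) (B : Subset d) (a : Point n) {e : ℕ} → IsMinOver M (λ B′ → ∣ B ─ B′ ∣) e →
  IsCoveringNumber M (subspace B a) (N ^ e)
  × (∃[ B′ ] (M B′ × B ⊆ B′) → N ^ e ≡ 1)
  × (¬ (∃[ B′ ] (M B′ × B ⊆ B′)) → N ≤ N ^ e)
subspace-coveringNumber-uniform {N = N} N≥1 n≡N M B a {e} e-min =
  subspace-coveringNumber (λ i → subst (1 ≤_) (sym (n≡N i)) N≥1) M B a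
    (IsMinOver-∘ (^-monoʳ-≤ N) (prodOver-const n≡N ∘ (B ─_)) e-min) ,
  (λ superset → cong (N ^_) (minCodim≡0 e-min superset)) ,
  (λ no-superset →
    subst (_≤ N ^ e) (^-identityʳ N) (^-monoʳ-≤ N (minCodim≥1 e-min no-superset)))
  where
  instance
    N≢0 : NonZero N
    N≢0 = >-nonZero N≥1

glue : ∀ {d} {n : Fin d → ℕ} → Subset d → Point n → Point n → Point n
glue C a₁ a₂ i with i ∈? C
... | yes _ = a₂ i
... | no  _ = a₁ i

subspace-∩ : ∀ {d} {n : Fin d → ℕ} {B₁ B₂ : Subset d} {a₁ a₂ x : Point n} →
  subspace B₁ a₁ x → subspace B₂ a₂ x → subspace (B₁ ∩ B₂) (glue B₁ a₁ a₂) x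
subspace-∩ {B₁ = B₁} x∈S₁ x∈S₂ i i∉B₁∩B₂ with i ∈? B₁
... | yes i∈B₁ = x∈S₂ i λ i∈B₂ → i∉B₁∩B₂ (x∈p∩q⁺ (i∈B₁ , i∈B₂))
... | no  i∉B₁ = x∈S₁ i i∉B₁

coveredBy-∧F : ∀ {d} {n : Fin d → ℕ} {M₁ M₂ : Family d} {A : Region n} {k₁ k₂} →
  CoveredBy M₁ A k₁ → CoveredBy M₂ A k₂ → CoveredBy (M₁ ∧F M₂) A (k₁ * k₂)
coveredBy-∧F {d} {n} {M₁} {M₂} {A} {k₁} {k₂} (S₁ , S₁∈M₁ , cover₁) (S₂ , S₂∈M₂ , cover₂) =
  S ∘ remQuot k₂ , S∈M₁∧M₂ ∘ remQuot k₂ , cover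
  where
  S : Fin k₁ × Fin k₂ → Subset d × Point n
  S (j₁ , j₂) =
    proj₁ (S₁ j₁) ∩ proj₁ (S₂ j₂) , glue (proj₁ (S₁ j₁)) (proj₂ (S₁ j₁)) (proj₂ (S₂ j₂))
  S∈M₁∧M₂ : ∀ j → (M₁ ∧F M₂) (proj₁ (S j))
  S∈M₁∧M₂ (j₁ , j₂) = _ , _ , S₁∈M₁ j₁ , S₂∈M₂ j₂ , refl
  cover : ∀ x → A x → ∃[ j ] uncurry subspace (S (remQuot k₂ j)) x
  cover x x∈A with j₁ , x∈S₁ ← cover₁ x x∈A | j₂ , x∈S₂ ← cover₂ x x∈A =
    combine j₁ j₂ ,
    subst (λ j → uncurry subspace (S j) x) (sym (remQuot-combine j₁ j₂)) (subspace-∩ x∈S₁ x∈S₂)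

proposition2p2 : (d : ℕ) → 1 ≤ d → (n : Fin d → ℕ) → (∀ i → 1 ≤ n i) →
    -- (i)
    ((M : Family d) → NonEmptyFamily M → (B : Subset d) → (a : Point n) →
      (m : ℕ) → IsMinOver M (λ B' → prodOver (B ─ B') n) m →
      IsCoveringNumber M (subspace B a) m)
    ×
    -- (i), in particular: n_1 = … = n_d = N
    ((N : ℕ) → (∀ i → n i ≡ N) →
      (M : Family d) → NonEmptyFamily M → (B : Subset d) → (a : Point n) →
      (e : ℕ) → IsMinOver M (λ B' → ∣ B ─ B' ∣) e →
      IsCoveringNumber M (subspace B a) (N ^ e)
      × ((∃[ B' ] (M B' × B ⊆ B')) → N ^ e ≡ 1)
      × (¬ (∃[ B' ] (M B' × B ⊆ B')) → N ≤ N ^ e))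
    ×
    -- (ii)
    ((M₁ M₂ : Family d) → NonEmptyFamily M₁ → NonEmptyFamily M₂ →
      (k₁ k₂ : ℕ) → (A : Region n) →
      CoveredBy M₁ A k₁ → CoveredBy M₂ A k₂ →
      CoveredBy (M₁ ∧F M₂) A (k₁ * k₂))
proposition2p2 (suc d) _ n n≥1 =
  (λ M _ B a _ → subspace-coveringNumber n≥1 M B a) ,
  (λ N n≡N M _ B a _ →
    subspace-coveringNumber-uniform (subst (1 ≤_) (n≡N fzero) (n≥1 fzero)) n≡N M B a) ,
  (λ _ _ _ _ _ _ _ → coveredBy-∧F)
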